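{- Let $\kappa$ be a cardinal and $U$ an ultrafilter over $\kappa$. Every Borel subset of ${}^{\omega}\kappa$ is $U$-measurable.
   Context: ${}^{\omega}\kappa$ has the product topology of discrete $\kappa$. ${}^{<\omega}\kappa$ is the set of finite sequences from $\kappa$, $\frown$ concatenation, $\langle\rangle$ the empty sequence; trees are subsets of ${}^{<\omega}\kappa$ closed under initial segments, $[T]$ their sets of infinite branches. $X\lfloor\sigma=\{s:\sigma\frown s\in X\}$. A tree $T$ is $U$-branching iff $\langle\rangle\in T$ and for each $\sigma\in T$, $\{\alpha:\sigma\frown\langle\alpha\rangle\in T\}\in U$. $X$ is $U$-measurable iff for each $\sigma\in{}^{<\omega}\kappa$ there is a $U$-branching $T$ with $[T]\subseteq X\lfloor\sigma$ or $[T]\cap X\lfloor\sigma=\emptyset$. -}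

module Defs where

open import Level using (Level; _⊔_) renaming (suc to lsuc; zero to lzero)
open import Data.Nat using (ℕ; zero; suc)
open import Data.List using (List; []; _∷_; _++_; [_])
open import Data.Product using (Σ; _×_; _,_)
open import Data.Sum using (_⊎_)
open import Relation.Nullary using (¬_)
open import Function.Bundles using (_⇔_)
import Data.Unit
import Data.Empty

-- Classical logic (the paper works in ZFC): excluded middle for small types.
ExcludedMiddle : Set₁
ExcludedMiddle = (P : Set) → P ⊎ ¬ P

module _ (κ : Set) where

  Subset : Set₁
  Subset = κ → Set

  record IsUltrafilter (U : Subset → Set) : Set₁ where
    field
      whole     : U (λ _ → Data.Unit.⊤)
      noEmpty   : ¬ U (λ _ → Data.Empty.⊥)
      upward    : {A B : Subset} → U A → (∀ α → A α → B α) → U B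
      meet      : {A B : Subset} → U A → U B → U (λ α → A α × B α)
      ultra     : (A : Subset) → U A ⊎ U (λ α → ¬ A α)

  -- infinite sequences (elements of ^ω κ) and finite sequences (^<ω κ = List κ)
  ωSeq : Set
  ωSeq = ℕ → κ

  take : ℕ → ωSeq → List κ
  take zero    f = []
  take (suc n) f = f 0 ∷ take n (λ i → f (suc i))

  _⌢_ : List κ → ωSeq → ωSeq
  ([] ⌢ f) n = f n
  ((a ∷ σ) ⌢ f) zero = a
  ((a ∷ σ) ⌢ f) (suc n) = (σ ⌢ f) n

  _⌊_ : (ωSeq → Set) → List κ → (ωSeq → Set)
  (X ⌊ σ) f = X (σ ⌢ f)

  IsTree : (List κ → Set) → Set
  IsTree T = ∀ σ τ → T (σ ++ τ) → T σ

  Body : (List κ → Set) → ωSeq → Set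
  Body T f = ∀ n → T (take n f)

  IsUBranching : (Subset → Set) → (List κ → Set) → Set
  IsUBranching U T = T [] × (∀ σ → T σ → U (λ α → T (σ ++ [ α ])))

  IsUMeasurable : (Subset → Set) → (ωSeq → Set) → Set₁
  IsUMeasurable U X =
    ∀ (σ : List κ) → Σ (List κ → Set) λ T →
      IsTree T × IsUBranching U T ×
      ((∀ f → Body T f → (X ⌊ σ) f) ⊎ (∀ f → Body T f → ¬ (X ⌊ σ) f))

  -- Open subsets of ^ω κ (product of discrete κ): unions of basic open
  -- sets N_s = {f : s ⊑ f}, s ranging over an arbitrary S ⊆ ^<ω κ.
  OpenBy : (List κ → Set) → ωSeq → Set
  OpenBy S f = Σ ℕ λ n → S (take n f)

  data IsBorel : (ωSeq → Set) → Set₁ where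
    open'  : (S : List κ → Set) → IsBorel (OpenBy S)
    compl  : {X : ωSeq → Set} → IsBorel X → IsBorel (λ f → ¬ X f)
    union  : {X : ℕ → ωSeq → Set} → (∀ n → IsBorel (X n)) →
             IsBorel (λ f → Σ ℕ λ n → X n f)
    ext    : {X Y : ωSeq → Set} → IsBorel X → (∀ f → X f ⇔ Y f) → IsBorel Y

-- Complements are trivial, and an open set is the countable union of the sets
-- {f : f ↾ n ∈ S}, each of which is constant below every node of length n; so
-- everything rests on countable unions ⋃ Xₙ.  Fix, for every node τ, a
-- U-branching tree deciding X_|τ| below τ.  Call τ good if that tree lies
-- inside X_|τ|, or if U-many successors of τ are good.  A good root unfolds into
-- a U-branching tree inside the union.  Otherwise badness propagates to U-many
-- successors, and below a bad τ the tree chosen at τ avoids X_|τ|; following at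
-- every node the trees of all its (finitely many) initial segments keeps the
-- tree U-branching, and its branches avoid every Xₙ.
module Submission where

open import Defs
open import Data.Bool using (Bool; T)
open import Data.Bool.Properties using (T-irrelevant)
open import Data.Empty using (⊥-elim)
open import Data.List using (List; []; _∷_; _++_; [_]; length)
open import Data.List.Properties using (++-assoc; ++-identityʳ)
open import Data.Nat using (ℕ; zero; suc; _+_; _≤_; s≤s)
open import Data.Nat.Properties using (<⇒≤; ≤-refl)
open import Data.Product using (Σ; _×_; _,_; proj₁; proj₂)
open import Data.Sum using (_⊎_; inj₁; inj₂)
open import Data.Unit using (⊤; tt)
open import Function using (_∘_)
open import Function.Bundles using (Equivalence)
open import Relation.Binary.PropositionalEquality using (_≡_; _≗_; refl; sym; trans; cong; cong₂; subst)
open import Relation.Nullary using (¬_; Dec)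
open import Relation.Nullary.Decidable using (isYes; fromSum; toWitness; fromWitness)
open import Relation.Unary using (_⊆′_; ∁; ⋃)

module Sequences (A : Set) where

  infixr 5 _⁀_
  _⁀_ : List A → ωSeq A → ωSeq A
  _⁀_ = _⌢_ A

  shift : ℕ → ωSeq A → ωSeq A
  shift n f i = f (n + i)

  ⁀-cong : ∀ σ {f g} → f ≗ g → σ ⁀ f ≗ σ ⁀ g
  ⁀-cong []      f≗g i       = f≗g i
  ⁀-cong (a ∷ σ) f≗g zero    = refl
  ⁀-cong (a ∷ σ) f≗g (suc i) = ⁀-cong σ f≗g i

  ⁀-++ : ∀ σ ρ f → (σ ++ ρ) ⁀ f ≗ σ ⁀ ρ ⁀ f
  ⁀-++ []      ρ f i       = refl
  ⁀-++ (a ∷ σ) ρ f zero    = refl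
  ⁀-++ (a ∷ σ) ρ f (suc i) = ⁀-++ σ ρ f i

  take-cong : ∀ n {f g} → f ≗ g → take A n f ≡ take A n g
  take-cong zero    f≗g = refl
  take-cong (suc n) f≗g = cong₂ _∷_ (f≗g 0) (take-cong n (f≗g ∘ suc))

  length-take : ∀ n f → length (take A n f) ≡ n
  length-take zero    f = refl
  length-take (suc n) f = cong suc (length-take n (shift 1 f))

  take-+ : ∀ n k f → take A (n + k) f ≡ take A n f ++ take A k (shift n f)
  take-+ zero    k f = refl
  take-+ (suc n) k f = cong (f 0 ∷_) (take-+ n k (shift 1 f))

  take-⁀-shift : ∀ n f → take A n f ⁀ shift n f ≗ f
  take-⁀-shift zero    f i       = refl
  take-⁀-shift (suc n) f zero    = refl
  take-⁀-shift (suc n) f (suc i) = take-⁀-shift n (shift 1 f) i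

  ⁀-snoc-head : ∀ σ f → (σ ++ [ f 0 ]) ⁀ shift 1 f ≗ σ ⁀ f
  ⁀-snoc-head σ f i = trans (⁀-++ σ [ f 0 ] (shift 1 f) i) (⁀-cong σ (take-⁀-shift 1 f) i)

  take-⁀-≤length : ∀ {n} σ ρ f g → n ≤ length ρ → take A n (σ ⁀ ρ ⁀ f) ≡ take A n (σ ⁀ ρ ⁀ g)
  take-⁀-≤length {zero}  σ       ρ       f g _       = refl
  take-⁀-≤length {suc n} []      (a ∷ ρ) f g (s≤s n≤) = cong (a ∷_) (take-⁀-≤length [] ρ f g n≤)
  take-⁀-≤length {suc n} (a ∷ σ) ρ       f g n<      = cong (a ∷_) (take-⁀-≤length σ ρ f g (<⇒≤ n<))

module UltrafilterMeasurability (lem : ExcludedMiddle) (κ : Set) (U : Subset κ → Set)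
                                (isU : IsUltrafilter κ U) where

  open IsUltrafilter isU
  open Sequences κ

  Seq : Set
  Seq = ωSeq κ

  Extensional : (Seq → Set) → Set
  Extensional X = ∀ {f g} → f ≗ g → X f → X g

  record UTree : Set₁ where
    field
      nodes     : List κ → Set
      closed    : IsTree κ nodes
      root      : nodes []
      branching : ∀ σ → nodes σ → U (λ α → nodes (σ ++ [ α ]))

    branches : Seq → Set
    branches = Body κ nodes

  open UTree

  Decided : (Seq → Set) → Set₁
  Decided X = Σ UTree λ Tr → branches Tr ⊆′ X ⊎ branches Tr ⊆′ ∁ X

  Measurable : (Seq → Set) → Set₁
  Measurable X = ∀ σ → Decided (λ f → X (σ ⁀ f))

  Measurable⇒IsUMeasurable : ∀ {X} → Measurable X → IsUMeasurable κ U X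
  Measurable⇒IsUMeasurable m σ with m σ
  ... | Tr , verdict = nodes Tr , closed Tr , (root Tr , branching Tr) , verdict

  full-tree : UTree
  full-tree = record
    { nodes     = λ _ → ⊤
    ; closed    = λ _ _ _ → tt
    ; root      = tt
    ; branching = λ _ _ → whole
    }

  constant-decided : ∀ {X} → (∀ f g → X f → X g) → Decided X
  constant-decided {X} constant with lem (∀ f → X f)
  ... | inj₁ all = full-tree , inj₁ (λ f _ → all f)
  ... | inj₂ ¬all = full-tree , inj₂ (λ f _ x → ¬all (λ g → constant f g x))

  decided-resp : ∀ {X Y} → X ⊆′ Y → Y ⊆′ X → Decided X → Decided Y
  decided-resp X⊆Y Y⊆X (Tr , inj₁ inside) = Tr , inj₁ (λ f b → X⊆Y f (inside f b))
  decided-resp X⊆Y Y⊆X (Tr , inj₂ avoids) = Tr , inj₂ (λ f b y → avoids f b (Y⊆X f y))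

  decided-∁ : ∀ {X} → Decided X → Decided (∁ X)
  decided-∁ (Tr , inj₁ inside) = Tr , inj₂ (λ f b ¬x → ¬x (inside f b))
  decided-∁ (Tr , inj₂ avoids) = Tr , inj₁ avoids

  measurable-residual : ∀ {X} → Extensional X → Measurable X → ∀ σ → Measurable (λ f → X (σ ⁀ f))
  measurable-residual X-ext m σ τ =
    decided-resp (λ f → X-ext (⁀-++ σ τ f)) (λ f → X-ext (sym ∘ ⁀-++ σ τ f)) (m (σ ++ τ))

  borel-extensional : ∀ {X} → IsBorel κ X → Extensional X
  borel-extensional (open' S)  f≗g (n , s)  = n , subst S (take-cong n f≗g) s
  borel-extensional (compl b)  f≗g ¬x x     = ¬x (borel-extensional b (sym ∘ f≗g) x)
  borel-extensional (union bs) f≗g (n , x)  = n , borel-extensional (bs n) f≗g x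
  borel-extensional (ext b eq) {f} {g} f≗g y =
    Equivalence.to (eq g) (borel-extensional b f≗g (Equivalence.from (eq f) y))

  module Fusion (Xs : ℕ → Seq → Set) (Xs-ext : ∀ n → Extensional (Xs n))
                (decided : ∀ τ → Decided (λ f → Xs (length τ) (τ ⁀ f))) where

    Y : Seq → Set
    Y = ⋃ ℕ Xs

    Y-ext : Extensional Y
    Y-ext f≗g (n , x) = n , Xs-ext n f≗g x

    tree : List κ → UTree
    tree τ = proj₁ (decided τ)

    -- The good successors are given by a Bool-valued predicate so that Good
    -- stays in Set, where the ultrafilter and excluded middle apply to it.
    data Good : List κ → Set where
      inside : ∀ {τ} → branches (tree τ) ⊆′ (λ f → Xs (length τ) (τ ⁀ f)) → Good τ
      branch : ∀ {τ} (A : κ → Bool) → U (T ∘ A) → (∀ α → T (A α) → Good (τ ++ [ α ])) → Good τ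

    good-nodes : ∀ {τ} → Good τ → List κ → Set
    good-nodes {τ} (inside _)   = nodes (tree τ)
    good-nodes (branch _ _ _) []      = ⊤
    good-nodes (branch A _ g) (α ∷ ρ) = Σ (T (A α)) λ t → good-nodes (g α t) ρ

    good-root : ∀ {τ} (p : Good τ) → good-nodes p []
    good-root {τ} (inside _)   = root (tree τ)
    good-root (branch _ _ _) = tt

    good-closed : ∀ {τ} (p : Good τ) → IsTree κ (good-nodes p)
    good-closed {τ} (inside _)   = closed (tree τ)
    good-closed (branch _ _ _) []      ρ _       = tt
    good-closed (branch _ _ g) (α ∷ σ) ρ (t , x) = t , good-closed (g α t) σ ρ x

    good-branching : ∀ {τ} (p : Good τ) σ → good-nodes p σ → U (λ α → good-nodes p (σ ++ [ α ]))
    good-branching {τ} (inside _)   = branching (tree τ)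
    good-branching (branch _ u g) []      _       = upward u (λ α t → t , good-root (g α t))
    good-branching (branch _ _ g) (α ∷ σ) (t , x) = upward (good-branching (g α t) σ x) (λ _ y → t , y)

    good-tree : ∀ {τ} → Good τ → UTree
    good-tree p = record
      { nodes     = good-nodes p
      ; closed    = good-closed p
      ; root      = good-root p
      ; branching = good-branching p
      }

    good-tree-inside : ∀ {τ} (p : Good τ) → branches (good-tree p) ⊆′ (λ f → Y (τ ⁀ f))
    good-tree-inside {τ} (inside i) f b = length τ , i f b
    good-tree-inside {τ} (branch A _ g) f b =
      Y-ext (⁀-snoc-head τ f) (good-tree-inside (g (f 0) t) (shift 1 f) b-tail)
      where
        t : T (A (f 0))
        t = proj₁ (b 1)

        b-tail : branches (good-tree (g (f 0) t)) (shift 1 f)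
        b-tail n = subst (λ s → good-nodes (g (f 0) s) (take κ n (shift 1 f)))
                         (T-irrelevant _ t) (proj₂ (b (suc n)))

    bad-children : ∀ τ → ¬ Good τ → U (λ α → ¬ Good (τ ++ [ α ]))
    bad-children τ bad with ultra (λ α → Good (τ ++ [ α ]))
    ... | inj₂ u = u
    ... | inj₁ u = ⊥-elim (bad (branch (λ α → isYes (good? α))
                                       (upward u (λ α → fromWitness {a? = good? α}))
                                       (λ α → toWitness {a? = good? α})))
      where
        good? : ∀ α → Dec (Good (τ ++ [ α ]))
        good? α = fromSum (lem (Good (τ ++ [ α ])))

    bad-avoids : ∀ τ → ¬ Good τ → branches (tree τ) ⊆′ ∁ (λ f → Xs (length τ) (τ ⁀ f))
    bad-avoids τ bad with proj₂ (decided τ)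
    ... | inj₁ i      = ⊥-elim (bad (inside i))
    ... | inj₂ avoids = avoids

    Fused FusedBelow : List κ → List κ → Set
    Fused τ ρ = ¬ Good τ × nodes (tree τ) ρ × FusedBelow τ ρ
    FusedBelow τ []      = ⊤
    FusedBelow τ (α ∷ ρ) = Fused (τ ++ [ α ]) ρ

    fused-closed : ∀ τ → IsTree κ (Fused τ)
    fused-closed τ []      ρ (bad , x , _)     = bad , closed (tree τ) [] ρ x , tt
    fused-closed τ (α ∷ σ) ρ (bad , x , below) =
      bad , closed (tree τ) (α ∷ σ) ρ x , fused-closed (τ ++ [ α ]) σ ρ below

    fused-branching : ∀ τ ρ → Fused τ ρ → U (λ α → Fused τ (ρ ++ [ α ]))
    fused-branching τ [] (bad , x , _) =
      upward (meet (branching (tree τ) [] x) (bad-children τ bad))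
             (λ α (y , bad-α) → bad , y , bad-α , root (tree (τ ++ [ α ])) , tt)
    fused-branching τ (α ∷ ρ) (bad , x , below) =
      upward (meet (branching (tree τ) (α ∷ ρ) x) (fused-branching (τ ++ [ α ]) ρ below))
             (λ _ (y , below-β) → bad , y , below-β)

    fused-tree : ¬ Good [] → UTree
    fused-tree bad = record
      { nodes     = Fused []
      ; closed    = fused-closed []
      ; root      = bad , root (tree []) , tt
      ; branching = fused-branching []
      }

    fused-drop : ∀ τ π {ρ} → Fused τ (π ++ ρ) → Fused (τ ++ π) ρ
    fused-drop τ []      {ρ} x = subst (λ τ′ → Fused τ′ ρ) (sym (++-identityʳ τ)) x
    fused-drop τ (α ∷ π) {ρ} (_ , _ , below) =
      subst (λ τ′ → Fused τ′ ρ) (++-assoc τ [ α ] π) (fused-drop (τ ++ [ α ]) π below)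

    fused-tree-avoids : (bad : ¬ Good []) → branches (fused-tree bad) ⊆′ ∁ Y
    fused-tree-avoids _ f b (n , x) =
      bad-avoids τ (proj₁ (fused-τ 0)) (shift n f) (proj₁ ∘ proj₂ ∘ fused-τ) x-τ
      where
        τ : List κ
        τ = take κ n f

        fused-τ : ∀ k → Fused τ (take κ k (shift n f))
        fused-τ k = fused-drop [] τ (subst (Fused []) (take-+ n k f) (b (n + k)))

        x-τ : Xs (length τ) (τ ⁀ shift n f)
        x-τ = subst (λ m → Xs m (τ ⁀ shift n f)) (sym (length-take n f))
                    (Xs-ext n (sym ∘ take-⁀-shift n f) x)

    ⋃-decided : Decided Y
    ⋃-decided with lem (Good [])
    ... | inj₁ good = good-tree good , inj₁ (good-tree-inside good)
    ... | inj₂ bad  = fused-tree bad , inj₂ (fused-tree-avoids bad)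

  open-measurable : (S : List κ → Set) → Measurable (OpenBy κ S)
  open-measurable S σ =
    Fusion.⋃-decided (λ n f → S (take κ n (σ ⁀ f)))
      (λ n f≗g → subst S (take-cong n (⁀-cong σ f≗g)))
      (λ τ → constant-decided (λ g h → subst S (take-⁀-≤length σ τ g h ≤-refl)))

  ⋃-measurable : ∀ {Xs} → (∀ n → Extensional (Xs n)) → (∀ n → Measurable (Xs n)) → Measurable (⋃ ℕ Xs)
  ⋃-measurable {Xs} Xs-ext m σ =
    Fusion.⋃-decided (λ n f → Xs n (σ ⁀ f))
      (λ n f≗g → Xs-ext n (⁀-cong σ f≗g))
      (λ τ → measurable-residual (Xs-ext (length τ)) (m (length τ)) σ τ)

  borel-measurable : ∀ {X} → IsBorel κ X → Measurable X
  borel-measurable (open' S)  = open-measurable S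
  borel-measurable (compl b)  = decided-∁ ∘ borel-measurable b
  borel-measurable (union bs) = ⋃-measurable (borel-extensional ∘ bs) (borel-measurable ∘ bs)
  borel-measurable (ext b eq) σ =
    decided-resp (λ _ → Equivalence.to (eq _)) (λ _ → Equivalence.from (eq _)) (borel-measurable b σ)

corollary5p7 : ExcludedMiddle → (κ : Set) → (U : Subset κ → Set) →
    IsUltrafilter κ U →
    (X : ωSeq κ → Set) → IsBorel κ X → IsUMeasurable κ U X
corollary5p7 lem κ U isU X =
  Measurable⇒IsUMeasurable {X} ∘ borel-measurable
  where open UltrafilterMeasurability lem κ U isU
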